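{- Let $M,I\subseteq[n]$ with $|M|=|I|$ and $n\in M\cap I$. There is an involution $\psi:\mathfrak{S}_n(M,I)\to\mathfrak{S}_n(M,I)$ such that for all $\pi\in\mathfrak{S}_n(M,I)$, $$\big(\mathrm{ca}(\pi),\mathrm{ci}(\pi)\big)=\big(\mathrm{ci}(\psi(\pi)),\mathrm{ca}(\psi(\pi))\big),$$ and moreover $|A^-(\psi(\pi))|=|A^-(\pi)|$.
   Context: For $\pi\in\mathfrak{S}_n$, a right-to-left maximum is a position $j$ with $\pi(j)>\pi(i)$ for all $i>j$. $\mathfrak{S}_n(M,I)$ is the set of $\pi\in\mathfrak{S}_n$ whose right-to-left maxima occur exactly at the positions in $I$ and whose right-to-left maximum values form exactly the set $M$. For values $x,y$ of $\pi$: $I^+(\pi)$ is the set of pairs $(y,x)$ with $y$ left of $x$, $y>x$, and some value $z>y$ to the right of $x$; $A^+(\pi)$ is the set of pairs $(x,y)$ with $x$ left of $y$, $x<y$, and some value $z>y$ to the right of $y$; $A^-(\pi)$ is the set of pairs $(x,y)$ with $x$ left of $y$, $x<y$, and no value larger than $y$ to the right of $y$. Functions $\mathrm{ci}(\pi),\mathrm{ca}(\pi):[n]\setminus M\to[n-1]$ are $\mathrm{ci}(\pi)(y)=|\{x:(y,x)\in I^+(\pi)\}|$ and $\mathrm{ca}(\pi)(y)=|\{x:(x,y)\in A^+(\pi)\}|$. -}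

module Defs where

open import Data.Nat using (ℕ; suc)
open import Data.Fin using (Fin; _<_; _<?_)
open import Data.Fin.Properties using (any?; all?)
open import Data.Fin.Subset using (Subset; _∈_; _∉_)
open import Data.Fin.Permutation using (Permutation′; _⟨$⟩ʳ_; _⟨$⟩ˡ_)
open import Data.List using (List; length; filter; cartesianProduct)
open import Data.Fin using (Fin)
open import Data.List using (allFin)
open import Data.Product using (Σ; ∃; _×_; _,_; proj₁; proj₂)
open import Data.Product.Properties using ()
open import Relation.Nullary using (Dec; ¬_; _×-dec_; ¬?)
open import Relation.Unary using (Pred; Decidable)
open import Relation.Binary.PropositionalEquality using (_≡_)
open import Function.Bundles using (_⇔_)
open import Level using (0ℓ)

-- Conventions: [n] = {1..n} is modelled by Fin n = {0..n-1}; both positions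
-- and values are elements of Fin n.

count : ∀ {n} {P : Pred (Fin n) 0ℓ} → Decidable P → ℕ
count {n} P? = length (filter P? (allFin n))

count₂ : ∀ {n} {P : Pred (Fin n × Fin n) 0ℓ} → Decidable P → ℕ
count₂ {n} P? = length (filter P? (cartesianProduct (allFin n) (allFin n)))

module _ {n : ℕ} (π : Permutation′ n) where

  val : Fin n → Fin n
  val j = π ⟨$⟩ʳ j

  pos : Fin n → Fin n
  pos v = π ⟨$⟩ˡ v

  IsRLMaxPos : Fin n → Set
  IsRLMaxPos j = ∀ i → j < i → val i < val j

  InIplus : Fin n → Fin n → Set
  InIplus y x = (pos y < pos x) × (x < y) × ∃ λ z → (pos x < pos z) × (y < z)

  InAplus : Fin n → Fin n → Set
  InAplus x y = (pos x < pos y) × (x < y) × ∃ λ z → (pos y < pos z) × (y < z)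

  InAminus : Fin n → Fin n → Set
  InAminus x y = (pos x < pos y) × (x < y) × ¬ (∃ λ z → (pos y < pos z) × (y < z))

  InIplus? : ∀ y → Decidable (InIplus y)
  InIplus? y x = (pos y <? pos x) ×-dec (x <? y)
                 ×-dec any? (λ z → (pos x <? pos z) ×-dec (y <? z))

  InAplus? : ∀ y → Decidable (λ x → InAplus x y)
  InAplus? y x = (pos x <? pos y) ×-dec (x <? y)
                 ×-dec any? (λ z → (pos y <? pos z) ×-dec (y <? z))

  InAminus? : Decidable (λ (p : Fin n × Fin n) → InAminus (proj₁ p) (proj₂ p))
  InAminus? (x , y) = (pos x <? pos y) ×-dec (x <? y)
                      ×-dec ¬? (any? (λ z → (pos y <? pos z) ×-dec (y <? z)))

  ci : Fin n → ℕ
  ci y = count (InIplus? y)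

  ca : Fin n → ℕ
  ca y = count (InAplus? y)

  sizeAminus : ℕ
  sizeAminus = count₂ InAminus?

  InSMI : Subset n → Subset n → Set
  InSMI M I = (∀ j → (j ∈ I ⇔ IsRLMaxPos j))
            × (∀ v → (v ∈ M ⇔ ∃ λ j → IsRLMaxPos j × val j ≡ v))

SMI : ∀ {n} → Subset n → Subset n → Set
SMI {n} M I = Σ (Permutation′ n) (λ π → InSMI π M I)

-- A position q is free for a value y if it carries a value ≤ y and some value > y lies to its
-- right.  When y is not a right-to-left maximum, ca(π)(y) and ci(π)(y) are the numbers of positions
-- free for y to the left and to the right of y.  The involution ψ treats the values from the
-- largest down, transposing each non-maximal value t with the position free for t that has exactly
-- ci(π)(t) free positions to its left.  Such a transposition only exchanges values ≤ t between
-- positions free for t, so it preserves the right-to-left maxima, the number of positions free for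
-- any value, and the free positions of every larger value; hence ψ exchanges the left and right
-- free counts of every non-maximal value.  Going down from the largest value, a permutation is
-- determined by its right-to-left maxima and its left free counts, so ψ ∘ ψ = id.  Finally, the
-- pairs of A⁻ with larger entry y exist only if y is a right-to-left maximum, and their number is
-- then fixed by the position of y, so |A⁻| depends only on the right-to-left maxima.

module Submission where

open import Data.Bool.Base using (if_then_else_)
open import Data.Fin.Base as Fin using (Fin; toℕ; fromℕ; fromℕ<; _<_; _≤_; _>_)
open import Data.Fin.Induction using (>-wellFounded)
open import Data.Fin.Permutation using (Permutation′; _⟨$⟩ʳ_; _∘ₚ_; _≈_; inverseˡ; inverseʳ; flip; transpose)
open import Data.Fin.Permutation.Components using () renaming (transpose to swapᶠ)
open import Data.Fin.Properties
  using ( _≟_; _<?_; _≤?_; any?; <-cmp; <-irrefl; <-asym; <-trans; ≤∧≢⇒<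
        ; toℕ<n; toℕ-injective; suc-injective; toℕ-fromℕ<)
open import Data.Fin.Subset using (Subset; _∈_; _∉_; ∣_∣)
open import Data.List.Base using (List; []; _∷_; length; filter; map; tabulate; _++_; allFin; cartesianProductWith)
open import Data.List.Properties using (filter-++; length-++)
open import Data.Nat.Base as ℕ using (ℕ; zero; suc; _+_; s≤s)
import Data.Nat.Properties as ℕ
open import Data.Product.Base using (∃; Σ-syntax; _×_; _,_; proj₁; proj₂)
open import Function.Base using (_∘_)
open import Function.Bundles using (mk⇔; Equivalence)
open import Induction.WellFounded using (Acc; acc)
open import Level using (0ℓ)
open import Relation.Binary.Definitions using (tri<; tri≈; tri>)
open import Relation.Binary.PropositionalEquality
open import Relation.Nullary using (Dec; yes; no; does; ¬_; ¬?; _×-dec_; contradiction)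
open import Relation.Nullary.Decidable using (does-⇔; dec-true; dec-false)
open import Relation.Unary using (Pred; Decidable; _⊆_; _≐_; _∩_; ∁; Empty)
open import Relation.Unary.Properties using (_∩?_; ∁?)
open import Algebra.Properties.CommutativeMonoid.Sum ℕ.+-0-commutativeMonoid
  using (sum; sum-cong-≗; ∑-distrib-+; ∑-comm; sum-permute; sum-replicate-zero)

open import Defs

-- Counting over Fin n

private
  variable
    n : ℕ
    A B : Set
    P Q : Pred (Fin n) 0ℓ

iverson : Dec A → ℕ
iverson A? = if does A? then 1 else 0

tally : Decidable P → ℕ
tally P? = sum (iverson ∘ P?)

length-filter-tabulate : ∀ {R : Pred A 0ℓ} (R? : Decidable R) (f : Fin n → A) →
  length (filter R? (tabulate f)) ≡ tally (R? ∘ f)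
length-filter-tabulate {n = zero} R? f = refl
length-filter-tabulate {n = suc n} R? f with R? (f Fin.zero)
... | yes _ = cong suc (length-filter-tabulate R? (f ∘ Fin.suc))
... | no _ = length-filter-tabulate R? (f ∘ Fin.suc)

length-filter-map : ∀ {R : Pred B 0ℓ} (R? : Decidable R) (g : A → B) (xs : List A) →
  length (filter R? (map g xs)) ≡ length (filter (R? ∘ g) xs)
length-filter-map R? g [] = refl
length-filter-map R? g (x ∷ xs) with R? (g x)
... | yes _ = cong suc (length-filter-map R? g xs)
... | no _ = length-filter-map R? g xs

count≡tally : (P? : Decidable P) → count P? ≡ tally P?
count≡tally P? = length-filter-tabulate P? (λ i → i)

length-filter-pairs : ∀ {k} {R : Pred (Fin n × Fin n) 0ℓ} (R? : Decidable R) (f : Fin k → Fin n) →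
  length (filter R? (cartesianProductWith _,_ (tabulate f) (allFin n)))
    ≡ sum (λ i → tally (λ y → R? (f i , y)))
length-filter-pairs {k = zero} R? f = refl
length-filter-pairs {n = n} {k = suc k} R? f = begin
  length (filter R? (map (f Fin.zero ,_) (allFin n) ++ rest))
    ≡⟨ cong length (filter-++ R? (map (f Fin.zero ,_) (allFin n)) rest) ⟩
  length (filter R? (map (f Fin.zero ,_) (allFin n)) ++ filter R? rest)
    ≡⟨ length-++ (filter R? (map (f Fin.zero ,_) (allFin n))) ⟩
  length (filter R? (map (f Fin.zero ,_) (allFin n))) + length (filter R? rest)
    ≡⟨ cong₂ _+_ (trans (length-filter-map R? (f Fin.zero ,_) (allFin n)) (count≡tally (R? ∘ (f Fin.zero ,_))))
                 (length-filter-pairs R? (f ∘ Fin.suc)) ⟩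
  sum (λ i → tally (λ y → R? (f i , y))) ∎
  where
  open ≡-Reasoning
  rest : List (Fin n × Fin n)
  rest = cartesianProductWith _,_ (tabulate (f ∘ Fin.suc)) (allFin n)

count₂≡∑tally : ∀ {R : Pred (Fin n × Fin n) 0ℓ} (R? : Decidable R) →
  count₂ R? ≡ sum (λ y → tally (λ x → R? (x , y)))
count₂≡∑tally R? = trans (length-filter-pairs R? (λ i → i)) (∑-comm (λ x y → iverson (R? (x , y))))

tally-cong : (P? : Decidable P) (Q? : Decidable Q) → P ≐ Q → tally P? ≡ tally Q?
tally-cong P? Q? (P⊆Q , Q⊆P) =
  sum-cong-≗ (λ i → cong (λ b → if b then 1 else 0) (does-⇔ (mk⇔ P⊆Q Q⊆P) (P? i) (Q? i)))

tally-permute : (P? : Decidable P) (Q? : Decidable Q) (ρ : Permutation′ n) →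
  P ≐ (Q ∘ (ρ ⟨$⟩ʳ_)) → tally P? ≡ tally Q?
tally-permute P? Q? ρ P≐Qρ =
  trans (tally-cong P? (Q? ∘ (ρ ⟨$⟩ʳ_)) P≐Qρ) (sym (sum-permute (iverson ∘ Q?) ρ))

tally-none : ∀ {n} {P : Pred (Fin n) 0ℓ} (P? : Decidable P) → Empty P → tally P? ≡ 0
tally-none {n} P? ∅ = trans (sum-cong-≗ (λ i → iverson-no (P? i) (∅ i))) (sum-replicate-zero n)
  where
  iverson-no : (A? : Dec A) → ¬ A → iverson A? ≡ 0
  iverson-no (yes a) ¬a = contradiction a ¬a
  iverson-no (no _) _ = refl

tally-split : (P? : Decidable P) (Q? : Decidable Q) →
  tally P? ≡ tally (P? ∩? Q?) + tally (P? ∩? ∁? Q?)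
tally-split P? Q? = trans (sum-cong-≗ (λ i → iverson-split (P? i) (Q? i)))
                          (∑-distrib-+ (iverson ∘ (P? ∩? Q?)) (iverson ∘ (P? ∩? ∁? Q?)))
  where
  iverson-split : ∀ {C D : Set} (C? : Dec C) (D? : Dec D) →
    iverson C? ≡ iverson (C? ×-dec D?) + iverson (C? ×-dec ¬? D?)
  iverson-split (yes _) (yes _) = refl
  iverson-split (yes _) (no _) = refl
  iverson-split (no _) _ = refl

tally-mono : (P? : Decidable P) (Q? : Decidable Q) → P ⊆ Q → tally P? ℕ.≤ tally Q?
tally-mono P? Q? P⊆Q = begin
  tally P?                                    ≡⟨ tally-cong P? (Q? ∩? P?) ((λ p → P⊆Q p , p) , proj₂) ⟩
  tally (Q? ∩? P?)                            ≤⟨ ℕ.m≤m+n _ _ ⟩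
  tally (Q? ∩? P?) + tally (Q? ∩? ∁? P?)      ≡⟨ tally-split Q? P? ⟨
  tally Q?                                    ∎
  where open ℕ.≤-Reasoning

tally-≟ : ∀ {n} (p : Fin n) → tally (_≟ p) ≡ 1
tally-≟ {suc n} Fin.zero = cong suc (tally-none (λ (i : Fin n) → Fin.suc i ≟ Fin.zero) (λ _ ()))
tally-≟ {suc n} (Fin.suc p) =
  trans (tally-cong (λ (i : Fin n) → Fin.suc i ≟ Fin.suc p) (_≟ p) (suc-injective , cong Fin.suc)) (tally-≟ p)

tally-pos : (P? : Decidable P) {p : Fin n} → P p → 0 ℕ.< tally P?
tally-pos P? {p} Pp = ℕ.≤-trans (ℕ.≤-reflexive (sym (tally-≟ p)))
                                (tally-mono (_≟ p) P? (λ { refl → Pp }))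

tally-< : ∀ {n} (p : Fin n) → tally (λ (i : Fin n) → i <? p) ≡ toℕ p
tally-< {suc n} Fin.zero = tally-none (λ (i : Fin (suc n)) → i <? Fin.zero {n}) (λ _ ())
tally-< {suc n} (Fin.suc p) =
  cong suc (trans (tally-cong (λ (i : Fin n) → Fin.suc i <? Fin.suc p) (λ i → i <? p) (ℕ.≤-pred , s≤s)) (tally-< p))

below above : Decidable P → Fin n → ℕ
below P? p = tally (P? ∩? (λ q → q <? p))
above P? p = tally (P? ∩? (λ q → p <? q))

below-cong : ∀ {n} {P Q : Pred (Fin n) 0ℓ} (P? : Decidable P) (Q? : Decidable Q) → P ≐ Q →
             ∀ (p : Fin n) → below P? p ≡ below Q? p
below-cong P? Q? (P⊆Q , Q⊆P) p = tally-cong (P? ∩? (λ q → q <? p)) (Q? ∩? (λ q → q <? p))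
  ((λ (Pq , q<p) → P⊆Q Pq , q<p) , (λ (Qq , q<p) → Q⊆P Qq , q<p))

tally-around : ∀ {n} {P : Pred (Fin n) 0ℓ} (P? : Decidable P) {p : Fin n} → P p →
               tally P? ≡ below P? p + suc (above P? p)
tally-around {P = P} P? {p} Pp = begin
  tally P?                                              ≡⟨ tally-split P? (λ q → q <? p) ⟩
  below P? p + tally notBelow                           ≡⟨ cong (below P? p +_) (tally-split notBelow (λ q → p <? q)) ⟩
  below P? p + (tally (notBelow ∩? (λ q → p <? q)) + tally (notBelow ∩? ∁? (λ q → p <? q)))
    ≡⟨ cong (below P? p +_) (cong₂ _+_ right-part centre) ⟩
  below P? p + (above P? p + 1)                         ≡⟨ cong (below P? p +_) (ℕ.+-comm (above P? p) 1) ⟩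
  below P? p + suc (above P? p)                         ∎
  where
  open ≡-Reasoning
  notBelow : Decidable (P ∩ ∁ (λ q → q < p))
  notBelow = P? ∩? ∁? (λ q → q <? p)
  right-part : tally (notBelow ∩? (λ q → p <? q)) ≡ above P? p
  right-part = tally-cong (notBelow ∩? (λ q → p <? q)) (P? ∩? (λ q → p <? q))
    ((λ ((Pq , _) , p<q) → Pq , p<q) , (λ (Pq , p<q) → (Pq , <-asym p<q) , p<q))
  centre : tally (notBelow ∩? ∁? (λ q → p <? q)) ≡ 1
  centre = trans (tally-cong (notBelow ∩? ∁? (λ q → p <? q)) (_≟ p)
                   ((λ ((_ , q≮p) , p≮q) →
                       toℕ-injective (ℕ.≤-antisym (ℕ.≮⇒≥ p≮q) (ℕ.≮⇒≥ q≮p))) ,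
                    (λ { refl → (Pp , <-irrefl refl) , <-irrefl refl })))
                 (tally-≟ p)

below-strictMono : ∀ {n} {P : Pred (Fin n) 0ℓ} (P? : Decidable P) {p p′ : Fin n} → P p → p < p′ →
                   below P? p ℕ.< below P? p′
below-strictMono {P = P} P? {p} {p′} Pp p<p′ = begin-strict
  below P? p                                           ≡⟨ ℕ.+-identityʳ _ ⟨
  below P? p + 0
    <⟨ ℕ.+-monoʳ-< (below P? p) (tally-pos between ((Pp , p<p′) , <-irrefl refl)) ⟩
  below P? p + tally between
    ≡⟨ cong (_+ tally between) lower ⟨
  tally ((P? ∩? (λ q → q <? p′)) ∩? (λ q → q <? p)) + tally between
    ≡⟨ tally-split (P? ∩? (λ q → q <? p′)) (λ q → q <? p) ⟨
  below P? p′                                          ∎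
  where
  open ℕ.≤-Reasoning
  between : Decidable ((P ∩ (λ q → q < p′)) ∩ ∁ (λ q → q < p))
  between = (P? ∩? (λ q → q <? p′)) ∩? ∁? (λ q → q <? p)
  lower : tally ((P? ∩? (λ q → q <? p′)) ∩? (λ q → q <? p)) ≡ below P? p
  lower = tally-cong ((P? ∩? (λ q → q <? p′)) ∩? (λ q → q <? p)) (P? ∩? (λ q → q <? p))
    ((λ ((Pq , _) , q<p) → Pq , q<p) , (λ (Pq , q<p) → (Pq , <-trans q<p p<p′) , q<p))

below-injective : (P? : Decidable P) {p p′ : Fin n} → P p → P p′ → below P? p ≡ below P? p′ → p ≡ p′
below-injective P? {p} {p′} Pp Pp′ eq with <-cmp p p′
... | tri< p<p′ _ _ = contradiction eq (ℕ.<⇒≢ (below-strictMono P? Pp p<p′))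
... | tri≈ _ p≡p′ _ = p≡p′
... | tri> _ _ p′<p = contradiction (sym eq) (ℕ.<⇒≢ (below-strictMono P? Pp′ p′<p))

module _ {n} {P : Pred (Fin (suc n)) 0ℓ} (P? : Decidable P) (q : Fin n) where

  below-suc-yes : P Fin.zero → below P? (Fin.suc q) ≡ suc (below (P? ∘ Fin.suc) q)
  below-suc-yes P0 with P? Fin.zero
  ... | yes _ = refl
  ... | no ¬P0 = contradiction P0 ¬P0

  below-suc-no : ¬ P Fin.zero → below P? (Fin.suc q) ≡ below (P? ∘ Fin.suc) q
  below-suc-no ¬P0 with P? Fin.zero
  ... | yes P0 = contradiction P0 ¬P0
  ... | no _ = refl

below-zero : ∀ {n} {P : Pred (Fin (suc n)) 0ℓ} (P? : Decidable P) → below P? (Fin.zero {n}) ≡ 0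
below-zero {n} P? = tally-none (P? ∩? (λ q → q <? Fin.zero {n})) (λ _ ())

below-select : ∀ {n} {P : Pred (Fin n) 0ℓ} (P? : Decidable P) {k : ℕ} →
  k ℕ.< tally P? → ∃ λ q → P q × below P? q ≡ k
below-select {suc n} {P} P? = select (P? Fin.zero)
  where
  select : (P0? : Dec (P Fin.zero)) {k : ℕ} → k ℕ.< iverson P0? + tally (P? ∘ Fin.suc) →
           ∃ λ q → P q × below P? q ≡ k
  select (yes P0) {zero} _ = Fin.zero , P0 , below-zero P?
  select (yes P0) {suc k} k< with below-select (P? ∘ Fin.suc) (ℕ.≤-pred k<)
  ... | q , Pq , eq = Fin.suc q , Pq , trans (below-suc-yes P? q P0) (cong suc eq)
  select (no ¬P0) k< with below-select (P? ∘ Fin.suc) k<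
  ... | q , Pq , eq = Fin.suc q , Pq , trans (below-suc-no P? q ¬P0) eq

-- Free positions and right-to-left maxima

module _ {n : ℕ} where

  private variable
    σ τ υ : Permutation′ n
    j : Fin n

  val-pos : (σ : Permutation′ n) (y : Fin n) → val σ (pos σ y) ≡ y
  val-pos σ y = inverseʳ σ

  pos-val : (σ : Permutation′ n) (j : Fin n) → pos σ (val σ j) ≡ j
  pos-val σ j = inverseˡ σ

  val-injective : (σ : Permutation′ n) {i j : Fin n} → val σ i ≡ val σ j → i ≡ j
  val-injective σ {i} {j} eq = trans (sym (pos-val σ i)) (trans (cong (pos σ) eq) (pos-val σ j))

  ExceededAfter : Permutation′ n → Fin n → Fin n → Set
  ExceededAfter σ y p = ∃ λ q → p < q × y < val σ q

  exceededAfter? : (σ : Permutation′ n) (y p : Fin n) → Dec (ExceededAfter σ y p)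
  exceededAfter? σ y p = any? (λ q → (p <? q) ×-dec (y <? val σ q))

  exceededAfter-mono : ∀ {σ y t p} → y ≤ t → ExceededAfter σ t p → ExceededAfter σ y p
  exceededAfter-mono y≤t (q , p<q , t<vq) = q , p<q , ℕ.≤-<-trans y≤t t<vq

  Dominated : Permutation′ n → Fin n → Set
  Dominated σ y = ExceededAfter σ y (pos σ y)

  Free : Permutation′ n → Fin n → Fin n → Set
  Free σ y q = val σ q ≤ y × ExceededAfter σ y q

  free? : (σ : Permutation′ n) (y q : Fin n) → Dec (Free σ y q)
  free? σ y q = (val σ q ≤? y) ×-dec exceededAfter? σ y q

  freeLeft freeRight freeCount : Permutation′ n → Fin n → ℕ
  freeLeft σ y = below (free? σ y) (pos σ y)
  freeRight σ y = above (free? σ y) (pos σ y)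
  freeCount σ y = tally (free? σ y)

  dominated⇒free : ∀ σ {y} → Dominated σ y → Free σ y (pos σ y)
  dominated⇒free σ {y} dom = ℕ.≤-reflexive (cong toℕ (val-pos σ y)) , dom

  ¬dominated⇒rlMax : (σ : Permutation′ n) (y : Fin n) → ¬ Dominated σ y → IsRLMaxPos σ (pos σ y)
  ¬dominated⇒rlMax σ y ¬dom i pos<i =
    ≤∧≢⇒< (subst (val σ i ≤_) (sym (val-pos σ y)) (ℕ.≮⇒≥ (λ y<i → ¬dom (i , pos<i , y<i))))
          (λ eq → <-irrefl (sym (val-injective σ eq)) pos<i)

  rlMax⇒¬exceededAfter : (σ : Permutation′ n) {j t : Fin n} →
                         IsRLMaxPos σ j → val σ j ≤ t → ¬ ExceededAfter σ t j
  rlMax⇒¬exceededAfter σ rl vj≤t (q , j<q , t<vq) = <-asym (rl q j<q) (ℕ.≤-<-trans vj≤t t<vq)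

  rlMax-exceeds : (σ : Permutation′ n) {j x t : Fin n} →
                  IsRLMaxPos σ j → j < x → ExceededAfter σ t x → t < val σ j
  rlMax-exceeds σ rl j<x (q , x<q , t<vq) = <-trans t<vq (rl q (<-trans j<x x<q))

  exceededAfter⇒byRLMax : (σ : Permutation′ n) {y p : Fin n} → ExceededAfter σ y p →
                          ∃ λ r → p < r × y < val σ r × IsRLMaxPos σ r
  exceededAfter⇒byRLMax σ {y} {p} (q , p<q , y<vq) = climb q (>-wellFounded (val σ q)) p<q y<vq
    where
    climb : ∀ q → Acc _>_ (val σ q) → p < q → y < val σ q →
            ∃ λ r → p < r × y < val σ r × IsRLMaxPos σ r
    climb q (acc rs) p<q y<vq with any? (λ i → (q <? i) ×-dec (val σ q <? val σ i))
    ... | yes (i , q<i , vq<vi) = climb i (rs vq<vi) (<-trans p<q q<i) (<-trans y<vq vq<vi)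
    ... | no none = q , p<q , y<vq , λ i q<i →
          ≤∧≢⇒< (ℕ.≮⇒≥ (λ vq<vi → none (i , q<i , vq<vi)))
                (λ eq → <-irrefl (sym (val-injective σ eq)) q<i)

  ca≡freeLeft : (σ : Permutation′ n) (y : Fin n) → Dominated σ y → ca σ y ≡ freeLeft σ y
  ca≡freeLeft σ y (q , pos<q , y<vq) = trans (count≡tally (InAplus? σ y))
    (tally-permute (InAplus? σ y) (free? σ y ∩? (λ r → r <? pos σ y)) (flip σ) (to , from))
    where
    to : ∀ {x} → InAplus σ x y → Free σ y (pos σ x) × pos σ x < pos σ y
    to {x} (posx<posy , x<y , _) =
      (subst (_≤ y) (sym (val-pos σ x)) (ℕ.<⇒≤ x<y) , q , <-trans posx<posy pos<q , y<vq) , posx<posy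
    from : ∀ {x} → Free σ y (pos σ x) × pos σ x < pos σ y → InAplus σ x y
    from {x} ((vx≤y , _) , posx<posy) =
      posx<posy ,
      ≤∧≢⇒< (subst (_≤ y) (val-pos σ x) vx≤y) (λ { refl → <-irrefl refl posx<posy }) ,
      val σ q , subst (pos σ y <_) (sym (pos-val σ q)) pos<q , y<vq

  ci≡freeRight : (σ : Permutation′ n) (y : Fin n) → ci σ y ≡ freeRight σ y
  ci≡freeRight σ y = trans (count≡tally (InIplus? σ y))
    (tally-permute (InIplus? σ y) (free? σ y ∩? (λ r → pos σ y <? r)) (flip σ) (to , from))
    where
    to : ∀ {x} → InIplus σ y x → Free σ y (pos σ x) × pos σ y < pos σ x
    to {x} (posy<posx , x<y , z , posx<posz , y<z) =
      (subst (_≤ y) (sym (val-pos σ x)) (ℕ.<⇒≤ x<y) , pos σ z , posx<posz , subst (y <_) (sym (val-pos σ z)) y<z) ,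
      posy<posx
    from : ∀ {x} → Free σ y (pos σ x) × pos σ y < pos σ x → InIplus σ y x
    from {x} ((vx≤y , q , posx<q , y<vq) , posy<posx) =
      posy<posx ,
      ≤∧≢⇒< (subst (_≤ y) (val-pos σ x) vx≤y) (λ { refl → <-irrefl refl posy<posx }) ,
      val σ q , subst (pos σ x <_) (sym (pos-val σ q)) posx<q , y<vq

  record SameRLMaxima (σ τ : Permutation′ n) : Set where
    field
      rlMax⇒ : IsRLMaxPos σ j → IsRLMaxPos τ j
      rlMax⇐ : IsRLMaxPos τ j → IsRLMaxPos σ j
      rlMax-val : IsRLMaxPos σ j → val σ j ≡ val τ j

  open SameRLMaxima public

  sameRL-refl : SameRLMaxima σ σ
  sameRL-refl = record { rlMax⇒ = λ rl → rl ; rlMax⇐ = λ rl → rl ; rlMax-val = λ _ → refl }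

  sameRL-sym : SameRLMaxima σ τ → SameRLMaxima τ σ
  sameRL-sym s = record
    { rlMax⇒ = rlMax⇐ s ; rlMax⇐ = rlMax⇒ s ; rlMax-val = λ rl → sym (rlMax-val s (rlMax⇐ s rl)) }

  sameRL-trans : SameRLMaxima σ τ → SameRLMaxima τ υ → SameRLMaxima σ υ
  sameRL-trans s s′ = record
    { rlMax⇒ = rlMax⇒ s′ ∘ rlMax⇒ s
    ; rlMax⇐ = rlMax⇐ s ∘ rlMax⇐ s′
    ; rlMax-val = λ rl → trans (rlMax-val s rl) (rlMax-val s′ (rlMax⇒ s rl))
    }

  exceededAfter-transfer : ∀ {σ τ y p} → SameRLMaxima σ τ → ExceededAfter σ y p → ExceededAfter τ y p
  exceededAfter-transfer {σ} {y = y} s exceeded with exceededAfter⇒byRLMax σ exceeded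
  ... | r , p<r , y<vr , rl = r , p<r , subst (y <_) (rlMax-val s rl) y<vr

  dominated-transfer : ∀ {σ τ y} → SameRLMaxima σ τ → Dominated σ y → Dominated τ y
  dominated-transfer {σ} {τ} {y} s dom with exceededAfter? τ y (pos τ y)
  ... | yes domτ = domτ
  ... | no ¬domτ = contradiction (subst (ExceededAfter σ y) posσ≡posτ dom)
                                  (rlMax⇒¬exceededAfter σ rlσ (ℕ.≤-reflexive (cong toℕ v≡y)))
    where
    rlσ : IsRLMaxPos σ (pos τ y)
    rlσ = rlMax⇐ s (¬dominated⇒rlMax τ y ¬domτ)
    v≡y : val σ (pos τ y) ≡ y
    v≡y = trans (rlMax-val s rlσ) (val-pos τ y)
    posσ≡posτ : pos σ y ≡ pos τ y
    posσ≡posτ = trans (cong (pos σ) (sym v≡y)) (pos-val σ (pos τ y))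

  inSMI-transfer : ∀ {M I σ τ} → SameRLMaxima σ τ → InSMI σ M I → InSMI τ M I
  inSMI-transfer s (positions , values) =
    (λ j → mk⇔ (rlMax⇒ s ∘ Equivalence.to (positions j)) (Equivalence.from (positions j) ∘ rlMax⇐ s)) ,
    (λ v → mk⇔ (λ v∈M → let (j , rl , eq) = Equivalence.to (values v) v∈M
                        in j , rlMax⇒ s rl , trans (sym (rlMax-val s rl)) eq)
               (λ (j , rl , eq) → Equivalence.from (values v) (j , rlMax⇐ s rl , trans (rlMax-val s (rlMax⇐ s rl)) eq)))

  ∉M⇒dominated : ∀ {M I} (σ : Permutation′ n) → InSMI σ M I → ∀ {y} → y ∉ M → Dominated σ y
  ∉M⇒dominated σ (_ , values) {y} y∉M with exceededAfter? σ y (pos σ y)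
  ... | yes dom = dom
  ... | no ¬dom = contradiction (Equivalence.from (values y) (pos σ y , ¬dominated⇒rlMax σ y ¬dom , val-pos σ y)) y∉M

-- Transposing two positions free for the same value

module _ {n : ℕ} where

  swapᶠ-ˡ : (i j : Fin n) → swapᶠ i j i ≡ j
  swapᶠ-ˡ i j rewrite dec-true (i ≟ i) refl = refl

  swapᶠ-ʳ : (i j : Fin n) → swapᶠ i j j ≡ i
  swapᶠ-ʳ i j with j ≟ i
  ... | yes j≡i = j≡i
  ... | no _ rewrite dec-true (j ≟ j) refl = refl

  swapᶠ-≢ : (i j : Fin n) {k : Fin n} → k ≢ i → k ≢ j → swapᶠ i j k ≡ k
  swapᶠ-≢ i j {k} k≢i k≢j rewrite dec-false (k ≟ i) k≢i | dec-false (k ≟ j) k≢j = refl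

  swapᶠ-elim : (P : Fin n → Set) (i j k : Fin n) →
    (k ≡ i → P j) → (k ≡ j → P i) → (k ≢ i → k ≢ j → P k) → P (swapᶠ i j k)
  swapᶠ-elim P i j k at-i at-j elsewhere = cases (k ≟ i) (k ≟ j)
    where
    cases : Dec (k ≡ i) → Dec (k ≡ j) → P (swapᶠ i j k)
    cases (yes refl) _ = subst P (sym (swapᶠ-ˡ k j)) (at-i refl)
    cases (no _) (yes refl) = subst P (sym (swapᶠ-ʳ i k)) (at-j refl)
    cases (no k≢i) (no k≢j) = subst P (sym (swapᶠ-≢ i j k≢i k≢j)) (elsewhere k≢i k≢j)

  swapᶠ-involutive : (i j k : Fin n) → swapᶠ i j (swapᶠ i j k) ≡ k
  swapᶠ-involutive i j k = swapᶠ-elim (λ z → swapᶠ i j z ≡ k) i j k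
    (λ { refl → swapᶠ-ʳ k j }) (λ { refl → swapᶠ-ˡ i k }) (λ k≢i k≢j → swapᶠ-≢ i j k≢i k≢j)

  module _ (σ σ′ : Permutation′ n) {a b t : Fin n} (σ′≗σ∘swap : ∀ i → val σ′ i ≡ val σ (swapᶠ a b i))
           (a-free : Free σ t a) (b-free : Free σ t b) where

    swap-preserves-rlMax : ∀ {j} → IsRLMaxPos σ j → IsRLMaxPos σ′ j × val σ′ j ≡ val σ j
    swap-preserves-rlMax {j} rl = stillMax , vj≡
      where
      free≢ : ∀ {x} → Free σ t x → j ≢ x
      free≢ (vx≤t , exceeded) refl = rlMax⇒¬exceededAfter σ rl vx≤t exceeded
      vj≡ : val σ′ j ≡ val σ j
      vj≡ = trans (σ′≗σ∘swap j) (cong (val σ) (swapᶠ-≢ a b (free≢ a-free) (free≢ b-free)))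
      stillMax : IsRLMaxPos σ′ j
      stillMax i j<i = subst₂ _<_ (sym (σ′≗σ∘swap i)) (sym vj≡)
        (swapᶠ-elim (λ z → val σ z < val σ j) a b i
          (λ { refl → ℕ.≤-<-trans (proj₁ b-free) (rlMax-exceeds σ rl j<i (proj₂ a-free)) })
          (λ { refl → ℕ.≤-<-trans (proj₁ a-free) (rlMax-exceeds σ rl j<i (proj₂ b-free)) })
          (λ _ _ → rl i j<i))

    swap-preserves-exceededAfter : ∀ {y p} → ExceededAfter σ y p → ExceededAfter σ′ y p
    swap-preserves-exceededAfter {y} exceeded with exceededAfter⇒byRLMax σ exceeded
    ... | r , p<r , y<vr , rl = r , p<r , subst (y <_) (sym (proj₂ (swap-preserves-rlMax rl))) y<vr

  swap-sameRL : (σ : Permutation′ n) {a b t : Fin n} → Free σ t a → Free σ t b →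
                SameRLMaxima σ (transpose a b ∘ₚ σ)
  swap-sameRL σ {a} {b} {t} a-free b-free = record
    { rlMax⇒ = proj₁ ∘ swap-preserves-rlMax σ σ′ (λ _ → refl) a-free b-free
    ; rlMax⇐ = proj₁ ∘ swap-preserves-rlMax σ′ σ σ≗σ′∘swap a-free′ b-free′
    ; rlMax-val = sym ∘ proj₂ ∘ swap-preserves-rlMax σ σ′ (λ _ → refl) a-free b-free
    }
    where
    σ′ : Permutation′ n
    σ′ = transpose a b ∘ₚ σ
    σ≗σ′∘swap : ∀ i → val σ i ≡ val σ′ (swapᶠ a b i)
    σ≗σ′∘swap i = cong (val σ) (sym (swapᶠ-involutive a b i))
    a-free′ : Free σ′ t a
    a-free′ = subst (_≤ t) (cong (val σ) (sym (swapᶠ-ˡ a b))) (proj₁ b-free) ,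
              swap-preserves-exceededAfter σ σ′ (λ _ → refl) a-free b-free (proj₂ a-free)
    b-free′ : Free σ′ t b
    b-free′ = subst (_≤ t) (cong (val σ) (sym (swapᶠ-ʳ a b))) (proj₁ a-free) ,
              swap-preserves-exceededAfter σ σ′ (λ _ → refl) a-free b-free (proj₂ b-free)

  module FreeSwap (σ : Permutation′ n) {a b t : Fin n} (a-free : Free σ t a) (b-free : Free σ t b) where

    σ′ : Permutation′ n
    σ′ = transpose a b ∘ₚ σ

    sameRL : SameRLMaxima σ σ′
    sameRL = swap-sameRL σ a-free b-free

    free-≐-above : ∀ {y} → t ≤ y → Free σ′ y ≐ Free σ y
    free-≐-above {y} t≤y =
      (λ {q} (vq≤y , exceeded) → value⇐ q vq≤y , exceededAfter-transfer (sameRL-sym sameRL) exceeded) ,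
      (λ {q} (vq≤y , exceeded) → value⇒ q vq≤y , exceededAfter-transfer sameRL exceeded)
      where
      small : ∀ {x} → Free σ t x → val σ x ≤ y
      small (vx≤t , _) = ℕ.≤-trans vx≤t t≤y
      value⇐ : ∀ q → val σ (swapᶠ a b q) ≤ y → val σ q ≤ y
      value⇐ q = swapᶠ-elim (λ z → val σ z ≤ y → val σ q ≤ y) a b q
        (λ { refl _ → small a-free }) (λ { refl _ → small b-free }) (λ _ _ vq≤y → vq≤y)
      value⇒ : ∀ q → val σ q ≤ y → val σ (swapᶠ a b q) ≤ y
      value⇒ q = swapᶠ-elim (λ z → val σ q ≤ y → val σ z ≤ y) a b q
        (λ { refl _ → small b-free }) (λ { refl _ → small a-free }) (λ _ _ vq≤y → vq≤y)

    free-≐-below : ∀ {y} → y ≤ t → Free σ′ y ≐ (Free σ y ∘ swapᶠ a b)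
    free-≐-below {y} y≤t =
      (λ {q} (vq≤y , exceeded) → vq≤y , move q (exceededAfter-transfer (sameRL-sym sameRL) exceeded)) ,
      (λ {q} (vq≤y , exceeded) → vq≤y , exceededAfter-transfer sameRL
         (subst (ExceededAfter σ y) (swapᶠ-involutive a b q) (move (swapᶠ a b q) exceeded)))
      where
      move : ∀ q → ExceededAfter σ y q → ExceededAfter σ y (swapᶠ a b q)
      move q = swapᶠ-elim (λ z → ExceededAfter σ y q → ExceededAfter σ y z) a b q
        (λ _ _ → exceededAfter-mono {σ = σ} y≤t (proj₂ b-free))
        (λ _ _ → exceededAfter-mono {σ = σ} y≤t (proj₂ a-free))
        (λ _ _ exceeded → exceeded)

    freeCount-swap : ∀ y → freeCount σ′ y ≡ freeCount σ y
    freeCount-swap y with t ≤? y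
    ... | yes t≤y = tally-cong (free? σ′ y) (free? σ y) (free-≐-above t≤y)
    ... | no t≰y =
      tally-permute (free? σ′ y) (free? σ y) (transpose a b) (free-≐-below (ℕ.<⇒≤ (ℕ.≰⇒> t≰y)))

    below-free-swap : ∀ {y} (p : Fin n) → t ≤ y → below (free? σ′ y) p ≡ below (free? σ y) p
    below-free-swap {y} p t≤y = below-cong (free? σ′ y) (free? σ y) (free-≐-above t≤y) p

    pos-swap : ∀ {y} → t < y → pos σ′ y ≡ pos σ y
    pos-swap {y} t<y = swapᶠ-≢ b a {pos σ y} (large≢ b-free) (large≢ a-free)
      where
      large≢ : ∀ {x} → Free σ t x → pos σ y ≢ x
      large≢ (vx≤t , _) refl = ℕ.<⇒≱ t<y (subst (_≤ t) (val-pos σ y) vx≤t)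

    freeLeft-swap : ∀ {y} → t < y → freeLeft σ′ y ≡ freeLeft σ y
    freeLeft-swap {y} t<y = trans (cong (below (free? σ′ y)) (pos-swap {y} t<y))
                                  (below-free-swap {y} (pos σ y) (ℕ.<⇒≤ t<y))

-- Reconstruction from the left free counts; the pairs of A⁻

module _ {n : ℕ} where

  val-≤-transfer : ∀ (σ τ : Permutation′ n) {y q : Fin n} →
                   (∀ {y′ : Fin n} → y < y′ → pos σ y′ ≡ pos τ y′) → val σ q ≤ y → val τ q ≤ y
  val-≤-transfer σ τ {y} {q} agree vσ≤y =
    ℕ.≮⇒≥ λ y<vτ → ℕ.<⇒≱ (subst (y <_) (vτ≡vσ y<vτ) y<vτ) vσ≤y
    where
    vτ≡vσ : y < val τ q → val τ q ≡ val σ q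
    vτ≡vσ y<vτ = begin
      val τ q                    ≡⟨ val-pos σ (val τ q) ⟨
      val σ (pos σ (val τ q))    ≡⟨ cong (val σ) (agree y<vτ) ⟩
      val σ (pos τ (val τ q))    ≡⟨ cong (val σ) (pos-val τ q) ⟩
      val σ q                    ∎
      where open ≡-Reasoning

  module _ {σ τ : Permutation′ n} (same : SameRLMaxima σ τ)
           (freeLeft≡ : ∀ {y} → Dominated σ y → freeLeft σ y ≡ freeLeft τ y) where

    pos-agree : ∀ y → Acc _>_ y → pos σ y ≡ pos τ y
    pos-agree y (acc rs) with exceededAfter? σ y (pos σ y)
    ... | no ¬dom = sym (trans (cong (pos τ) (sym vτ≡y)) (pos-val τ (pos σ y)))
      where
      rl : IsRLMaxPos σ (pos σ y)
      rl = ¬dominated⇒rlMax σ y ¬dom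
      vτ≡y : val τ (pos σ y) ≡ y
      vτ≡y = trans (sym (rlMax-val same rl)) (val-pos σ y)
    ... | yes dom = below-injective (free? σ y) (dominated⇒free σ dom) τ-dominated⇒free (begin
      below (free? σ y) (pos σ y)     ≡⟨ freeLeft≡ dom ⟩
      below (free? τ y) (pos τ y)
        ≡⟨ below-cong (free? τ y) (free? σ y) (proj₂ free≐ , proj₁ free≐) (pos τ y) ⟩
      below (free? σ y) (pos τ y)     ∎)
      where
      open ≡-Reasoning
      agree : ∀ {y′ : Fin n} → y < y′ → pos σ y′ ≡ pos τ y′
      agree {y′} y<y′ = pos-agree y′ (rs y<y′)
      free≐ : Free σ y ≐ Free τ y
      free≐ = (λ (v≤y , exceeded) → val-≤-transfer σ τ agree v≤y ,
                                     exceededAfter-transfer same exceeded) ,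
              (λ (v≤y , exceeded) → val-≤-transfer τ σ (sym ∘ agree) v≤y ,
                                     exceededAfter-transfer (sameRL-sym same) exceeded)
      τ-dominated⇒free : Free σ y (pos τ y)
      τ-dominated⇒free = proj₂ free≐ (dominated⇒free τ (dominated-transfer same dom))

    sameRL-freeLeft⇒≈ : σ ≈ τ
    sameRL-freeLeft⇒≈ j = begin
      val σ j                      ≡⟨ cong (val σ) (pos-val τ j) ⟨
      val σ (pos τ (val τ j))      ≡⟨ cong (val σ) (pos-agree (val τ j) (>-wellFounded _)) ⟨
      val σ (pos σ (val τ j))      ≡⟨ val-pos σ (val τ j) ⟩
      val τ j                      ∎
      where open ≡-Reasoning

  aminusColumn : Permutation′ n → Fin n → ℕ
  aminusColumn σ y = tally (λ x → InAminus? σ (x , y))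

  aminusColumn-dominated : ∀ σ {y} → Dominated σ y → aminusColumn σ y ≡ 0
  aminusColumn-dominated σ {y} (q , pos<q , y<vq) = tally-none (λ x → InAminus? σ (x , y))
    (λ _ (_ , _ , ¬exceeded) → ¬exceeded (val σ q , subst (pos σ y <_) (sym (pos-val σ q)) pos<q , y<vq))

  -- Each position left of the maximum j carries either a value below y, forming a pair of A⁻
  -- with y, or one of the values above y.
  aminusColumn-rlMax : ∀ σ {j y} → IsRLMaxPos σ j → val σ j ≡ y →
                       aminusColumn σ y + tally (λ (x : Fin n) → y <? x) ≡ toℕ j
  aminusColumn-rlMax σ {j} {y} rl vj≡y = begin
    aminusColumn σ y + tally (λ (x : Fin n) → y <? x)
      ≡⟨ cong₂ _+_ left right ⟨
    tally (before ∩? (λ q → val σ q <? y)) + tally (before ∩? ∁? (λ q → val σ q <? y))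
      ≡⟨ tally-split before (λ q → val σ q <? y) ⟨
    tally before
      ≡⟨ tally-< j ⟩
    toℕ j ∎
    where
    open ≡-Reasoning
    before : Decidable (λ (q : Fin n) → q < j)
    before q = q <? j
    posy≡j : pos σ y ≡ j
    posy≡j = trans (cong (pos σ) (sym vj≡y)) (pos-val σ j)
    left : tally (before ∩? (λ q → val σ q <? y)) ≡ aminusColumn σ y
    left = sym (tally-permute (λ x → InAminus? σ (x , y)) (before ∩? (λ q → val σ q <? y)) (flip σ)
      ((λ {x} (posx<posy , x<y , _) → subst (pos σ x <_) posy≡j posx<posy , subst (_< y) (sym (val-pos σ x)) x<y) ,
       (λ {x} (posx<j , vx<y) → subst (pos σ x <_) (sym posy≡j) posx<j , subst (_< y) (val-pos σ x) vx<y ,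
          λ (z , posy<posz , y<z) → <-asym y<z (subst₂ _<_ (val-pos σ z) vj≡y
                                                  (rl (pos σ z) (subst (_< pos σ z) posy≡j posy<posz))))))
    right : tally (before ∩? ∁? (λ q → val σ q <? y)) ≡ tally (λ (x : Fin n) → y <? x)
    right = tally-permute (before ∩? ∁? (λ q → val σ q <? y)) (λ (x : Fin n) → y <? x) σ
      ((λ {q} (q<j , vq≮y) →
          ≤∧≢⇒< (ℕ.≮⇒≥ vq≮y) (λ y≡vq → <-irrefl (sym (val-injective σ (trans vj≡y y≡vq))) q<j)) ,
       (λ y<vq → larger⇒before y<vq , <-asym y<vq))
      where
      larger⇒before : ∀ {q} → y < val σ q → q < j
      larger⇒before {q} y<vq with <-cmp q j
      ... | tri< q<j _ _ = q<j
      ... | tri≈ _ refl _ = contradiction (subst (y <_) vj≡y y<vq) (<-irrefl refl)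
      ... | tri> _ _ j<q = contradiction (subst (val σ q <_) vj≡y (rl q j<q)) (<-asym y<vq)

  sizeAminus-sameRL : ∀ {σ τ} → SameRLMaxima σ τ → sizeAminus σ ≡ sizeAminus τ
  sizeAminus-sameRL {σ} {τ} same = begin
    sizeAminus σ                       ≡⟨ count₂≡∑tally (InAminus? σ) ⟩
    sum (aminusColumn σ)               ≡⟨ sum-cong-≗ column≡ ⟩
    sum (aminusColumn τ)               ≡⟨ count₂≡∑tally (InAminus? τ) ⟨
    sizeAminus τ                       ∎
    where
    open ≡-Reasoning
    column≡ : ∀ y → aminusColumn σ y ≡ aminusColumn τ y
    column≡ y with exceededAfter? σ y (pos σ y)
    ... | yes dom = trans (aminusColumn-dominated σ dom) (sym (aminusColumn-dominated τ (dominated-transfer same dom)))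
    ... | no ¬dom = ℕ.+-cancelʳ-≡ _ _ _ (trans (aminusColumn-rlMax σ rl (val-pos σ y))
                                              (sym (aminusColumn-rlMax τ (rlMax⇒ same rl) vτ≡y)))
      where
      rl : IsRLMaxPos σ (pos σ y)
      rl = ¬dominated⇒rlMax σ y ¬dom
      vτ≡y : val τ (pos σ y) ≡ y
      vτ≡y = trans (sym (rlMax-val same rl)) (val-pos σ y)

-- The sweep defining ψ

module _ {n : ℕ} (π : Permutation′ n) where

  Compatible : Permutation′ n → Set
  Compatible σ = SameRLMaxima π σ × (∀ y → freeCount σ y ≡ freeCount π y)

  compatible-refl : Compatible π
  compatible-refl = sameRL-refl , λ _ → refl

  Target : Permutation′ n → Fin n → Set
  Target σ t = Free σ t (pos σ t) × ∃ λ q → Free σ t q × below (free? σ t) q ≡ freeRight π t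

  target? : (σ : Permutation′ n) (t : Fin n) → Dec (Target σ t)
  target? σ t = free? σ t (pos σ t)
            ×-dec any? (λ q → free? σ t q ×-dec (below (free? σ t) q ℕ.≟ freeRight π t))

  moveToTarget : (σ : Permutation′ n) (t : Fin n) → Dec (Target σ t) → Permutation′ n
  moveToTarget σ t (yes (_ , q , _)) = transpose (pos σ t) q ∘ₚ σ
  moveToTarget σ t (no _) = σ

  moveToTarget-compatible : ∀ {σ} t → Compatible σ → ∀ d → Compatible (moveToTarget σ t d)
  moveToTarget-compatible {σ} t (same , counts) (yes (pos-free , q , q-free , _)) =
    sameRL-trans same (FreeSwap.sameRL σ pos-free q-free) ,
    λ y → trans (FreeSwap.freeCount-swap σ pos-free q-free y) (counts y)
  moveToTarget-compatible t compatible (no _) = compatible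

  moveToTarget-freeLeft : ∀ σ {t y} → t < y → ∀ d → freeLeft (moveToTarget σ t d) y ≡ freeLeft σ y
  moveToTarget-freeLeft σ t<y (yes (pos-free , q , q-free , _)) = FreeSwap.freeLeft-swap σ pos-free q-free t<y
  moveToTarget-freeLeft σ t<y (no _) = refl

  target-exists : ∀ {σ t} → Compatible σ → Dominated π t → Target σ t
  target-exists {σ} {t} (same , counts) dom =
    dominated⇒free σ (dominated-transfer same dom) ,
    below-select (free? σ t) k<count
    where
    k<count : freeRight π t ℕ.< freeCount σ t
    k<count = begin-strict
      freeRight π t                           <⟨ ℕ.m<n+m (freeRight π t) ℕ.z<s ⟩
      suc (freeRight π t)                     ≤⟨ ℕ.m≤n+m _ (freeLeft π t) ⟩
      freeLeft π t + suc (freeRight π t)      ≡⟨ tally-around (free? π t) (dominated⇒free π dom) ⟨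
      freeCount π t                           ≡⟨ counts t ⟨
      freeCount σ t                           ∎
      where open ℕ.≤-Reasoning

  moveToTarget-achieves : ∀ {σ t} → Compatible σ → Dominated π t →
                          ∀ d → freeLeft (moveToTarget σ t d) t ≡ freeRight π t
  moveToTarget-achieves {σ} {t} _ _ (yes (pos-free , q , q-free , below≡)) = begin
    below (free? σ′ t) (swapᶠ q (pos σ t) (pos σ t))    ≡⟨ cong (below (free? σ′ t)) (swapᶠ-ʳ q (pos σ t)) ⟩
    below (free? σ′ t) q                                ≡⟨ FreeSwap.below-free-swap σ pos-free q-free q ℕ.≤-refl ⟩
    below (free? σ t) q                                 ≡⟨ below≡ ⟩
    freeRight π t                                       ∎
    where
    open ≡-Reasoning
    σ′ : Permutation′ n
    σ′ = transpose (pos σ t) q ∘ₚ σ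
  moveToTarget-achieves compatible dom (no ¬target) = contradiction (target-exists compatible dom) ¬target

  step : Fin n → Permutation′ n → Permutation′ n
  step t σ = moveToTarget σ t (target? σ t)

  sweep : (k : ℕ) → k ℕ.≤ n → Permutation′ n → Permutation′ n
  sweep zero _ σ = σ
  sweep (suc k) k<n σ = sweep k (ℕ.<⇒≤ k<n) (step (fromℕ< k<n) σ)

  sweep-compatible : ∀ k (k≤n : k ℕ.≤ n) {σ} → Compatible σ → Compatible (sweep k k≤n σ)
  sweep-compatible zero _ compatible = compatible
  sweep-compatible (suc k) k<n {σ} compatible =
    sweep-compatible k _ (moveToTarget-compatible (fromℕ< k<n) compatible (target? σ (fromℕ< k<n)))

  sweep-freeLeft : ∀ k (k≤n : k ℕ.≤ n) σ {y} → k ℕ.≤ toℕ y → freeLeft (sweep k k≤n σ) y ≡ freeLeft σ y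
  sweep-freeLeft zero _ σ _ = refl
  sweep-freeLeft (suc k) k<n σ k<y =
    trans (sweep-freeLeft k _ _ (ℕ.<⇒≤ k<y))
          (moveToTarget-freeLeft σ (subst (ℕ._< _) (sym (toℕ-fromℕ< k<n)) k<y) (target? σ (fromℕ< k<n)))

  sweep-achieves : ∀ k (k≤n : k ℕ.≤ n) {σ y} → Compatible σ → toℕ y ℕ.< k → Dominated π y →
                   freeLeft (sweep k k≤n σ) y ≡ freeRight π y
  sweep-achieves (suc k) k<n {σ} {y} compatible y<k+1 dom with toℕ y ℕ.≟ k
  ... | no y≢k = sweep-achieves k _ (moveToTarget-compatible _ compatible (target? σ _))
                                    (ℕ.≤∧≢⇒< (ℕ.≤-pred y<k+1) y≢k) dom
  ... | yes y≡k =
    trans (sweep-freeLeft k _ _ (ℕ.≤-reflexive (sym y≡k)))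
          (subst (λ t → freeLeft (step t σ) y ≡ freeRight π y) (sym k≡y)
                 (moveToTarget-achieves compatible dom (target? σ y)))
    where
    k≡y : fromℕ< k<n ≡ y
    k≡y = toℕ-injective (trans (toℕ-fromℕ< k<n) (sym y≡k))

module _ {n : ℕ} where

  ψ : Permutation′ n → Permutation′ n
  ψ π = sweep π n ℕ.≤-refl π

  ψ-compatible : (π : Permutation′ n) → Compatible π (ψ π)
  ψ-compatible π = sweep-compatible π n ℕ.≤-refl (compatible-refl π)

  ψ-sameRL : (π : Permutation′ n) → SameRLMaxima π (ψ π)
  ψ-sameRL π = proj₁ (ψ-compatible π)

  ψ-freeLeft : (π : Permutation′ n) {y : Fin n} → Dominated π y → freeLeft (ψ π) y ≡ freeRight π y
  ψ-freeLeft π {y} = sweep-achieves π n ℕ.≤-refl (compatible-refl π) (toℕ<n y)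

  ψ-freeRight : (π : Permutation′ n) {y : Fin n} → Dominated π y → freeRight (ψ π) y ≡ freeLeft π y
  ψ-freeRight π {y} dom = ℕ.suc-injective (ℕ.+-cancelˡ-≡ (freeRight π y) _ _ (begin
    freeRight π y + suc (freeRight (ψ π) y)       ≡⟨ cong (_+ suc (freeRight (ψ π) y)) (ψ-freeLeft π dom) ⟨
    freeLeft (ψ π) y + suc (freeRight (ψ π) y)    ≡⟨ tally-around (free? (ψ π) y) (dominated⇒free (ψ π) domψ) ⟨
    freeCount (ψ π) y                             ≡⟨ proj₂ (ψ-compatible π) y ⟩
    freeCount π y                                 ≡⟨ tally-around (free? π y) (dominated⇒free π dom) ⟩
    freeLeft π y + suc (freeRight π y)            ≡⟨ ℕ.+-suc (freeLeft π y) _ ⟩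
    suc (freeLeft π y) + freeRight π y            ≡⟨ ℕ.+-comm (suc (freeLeft π y)) _ ⟩
    freeRight π y + suc (freeLeft π y)            ∎))
    where
    open ≡-Reasoning
    domψ : Dominated (ψ π) y
    domψ = dominated-transfer (ψ-sameRL π) dom

  ψ-involutive : (π : Permutation′ n) → ψ (ψ π) ≈ π
  ψ-involutive π = sameRL-freeLeft⇒≈ (sameRL-sym same) freeLeft≡
    where
    same : SameRLMaxima π (ψ (ψ π))
    same = sameRL-trans (ψ-sameRL π) (ψ-sameRL (ψ π))
    freeLeft≡ : ∀ {y} → Dominated (ψ (ψ π)) y → freeLeft (ψ (ψ π)) y ≡ freeLeft π y
    freeLeft≡ dom = trans (ψ-freeLeft (ψ π) (dominated-transfer (sameRL-sym (ψ-sameRL (ψ π))) dom))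
                          (ψ-freeRight π (dominated-transfer (sameRL-sym same) dom))

  ψ-ca : (π : Permutation′ n) {y : Fin n} → Dominated π y → ca π y ≡ ci (ψ π) y
  ψ-ca π {y} dom = begin
    ca π y               ≡⟨ ca≡freeLeft π y dom ⟩
    freeLeft π y         ≡⟨ ψ-freeRight π dom ⟨
    freeRight (ψ π) y    ≡⟨ ci≡freeRight (ψ π) y ⟨
    ci (ψ π) y           ∎
    where open ≡-Reasoning

  ψ-ci : (π : Permutation′ n) {y : Fin n} → Dominated π y → ci π y ≡ ca (ψ π) y
  ψ-ci π {y} dom = begin
    ci π y               ≡⟨ ci≡freeRight π y ⟩
    freeRight π y        ≡⟨ ψ-freeLeft π dom ⟨
    freeLeft (ψ π) y     ≡⟨ ca≡freeLeft (ψ π) y (dominated-transfer (ψ-sameRL π) dom) ⟨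
    ca (ψ π) y           ∎
    where open ≡-Reasoning

  ψ-sizeAminus : (π : Permutation′ n) → sizeAminus (ψ π) ≡ sizeAminus π
  ψ-sizeAminus π = sizeAminus-sameRL (sameRL-sym (ψ-sameRL π))

ψ-SMI : ∀ {n} {M I : Subset n} → SMI M I → SMI M I
ψ-SMI (π , π∈SMI) = ψ π , inSMI-transfer (ψ-sameRL π) π∈SMI

mainTheorem7 : (m : ℕ) (M I : Subset (suc m)) →
    ∣ M ∣ ≡ ∣ I ∣ → fromℕ m ∈ M → fromℕ m ∈ I →
    Σ[ ψ ∈ (SMI M I → SMI M I) ]
      ((∀ π → proj₁ (ψ (ψ π)) ≈ proj₁ π)
      × (∀ π → (∀ (y : Fin (suc m)) → y ∉ M →
                  (ca (proj₁ π) y ≡ ci (proj₁ (ψ π)) y)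
                  × (ci (proj₁ π) y ≡ ca (proj₁ (ψ π)) y))
               × (sizeAminus (proj₁ (ψ π)) ≡ sizeAminus (proj₁ π))))
mainTheorem7 m M I _ _ _ =
  ψ-SMI ,
  (λ (π , _) → ψ-involutive π) ,
  λ (π , π∈SMI) →
    (λ y y∉M → let dom = ∉M⇒dominated π π∈SMI y∉M in ψ-ca π dom , ψ-ci π dom) ,
    ψ-sizeAminus π
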